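{- Let $n\ge 4$, let $r \ge 3$ be real, and let $T$ be a triangulation of the convex $n$-gon with vertices labelled $0,\ldots,n-1$ clockwise. Let $AC$ be a non-boundary edge of $T$ whose quadrilateral is $ABCD$ with $A<B<C<D$, and let $T'$ be the triangulation obtained from $T$ by flipping $AC$ (i.e. replacing $AC$ by $BD$). If the scales $\sigma_{AC}$, $\sigma_{BD}$ and $\sigma_{BC}$ are pairwise distinct, then $(l_{T'},m_{T'},r_{T'},z_{T'}) \ne (l_T,m_T,r_T,z_T)$.
   Context: Triangulations contain the boundary edges $01,12,\ldots,(n-1)0$. For a non-boundary edge $e$ of a triangulation $T$, its quadrilateral is the union of the two triangles of $T$ containing $e$; its vertices are listed in increasing order. Flipping $e$ replaces $e$ by the other diagonal of its quadrilateral. For a parameter $r$ and an edge $e=UV$, the scale of $e$ is $\sigma_e=\lceil \log_r |U-V|\rceil$. For a triangle $ABC$ of a triangulation with $A<B<C$: if $AB$ is the unique edge of the triangle whose scale differs from the (equal) scales of the other two, the triangle is type-$l$; if this unique edge is $BC$ it is type-$m$; if it is $AC$ it is type-$r$; if all three edges have the same scale it is type-$z$. For a triangulation $T$, $(l_T,m_T,r_T,z_T)$ denotes the numbers of type-$l$, type-$m$, type-$r$ and type-$z$ triangles of $T$. -}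

module Defs where

open import Level using (0ℓ)
open import Data.Nat as ℕ using (ℕ; zero; suc; _+_; _∸_; _≡ᵇ_; _<ᵇ_)
open import Data.Bool using (Bool; true; false; _∧_; not; if_then_else_)
open import Data.Integer using (+_)
open import Data.Rational as ℚ using (ℚ)
open import Data.Product using (Σ; ∃; _×_; _,_)
open import Data.Sum using (_⊎_)
open import Data.Empty using (⊥)
open import Data.List using (List; []; _∷_; filterᵇ; length; upTo; concatMap; map; any; all)
open import Data.List.Membership.Propositional using (_∈_)
open import Data.List.Relation.Unary.Unique.Propositional using (Unique)
open import Relation.Nullary using (¬_)
open import Relation.Binary.PropositionalEquality using (_≡_)
open import Relation.Nullary.Decidable using (⌊_⌋)

-- Real numbers as (two-sided, located) Dedekind cuts of ℚ.
-- L q : "q < x",  U q : "x < q".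

record ℝ : Set₁ where
  field
    L U       : ℚ → Set
    L-inhab   : ∃ λ q → L q
    U-inhab   : ∃ λ q → U q
    L-down    : ∀ {p q} → L q → p ℚ.< q → L p
    L-round   : ∀ {q} → L q → ∃ λ p → q ℚ.< p × L p
    U-up      : ∀ {p q} → U p → p ℚ.< q → U q
    U-round   : ∀ {q} → U q → ∃ λ p → p ℚ.< q × U p
    disjoint  : ∀ {q} → L q → U q → ⊥
    located   : ∀ {p q} → p ℚ.< q → L p ⊎ U q

open ℝ public

ℕ→ℚ : ℕ → ℚ
ℕ→ℚ d = (+ d) ℚ./ 1

_^ℚ_ : ℚ → ℕ → ℚ
q ^ℚ zero  = ℚ.1ℚ
q ^ℚ suc k = q ℚ.* (q ^ℚ k)

AtLeast3 : ℝ → Set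
AtLeast3 x = ¬ U x (ℕ→ℚ 3)

-- d ≤ x ^ k   (for x > 0):  not (x^k < d), where x^k < d iff
-- some rational q > x satisfies q^k < d
LeqPow : ℝ → ℕ → ℕ → Set
LeqPow x d k = ¬ (Σ ℚ λ q → U x q × (q ^ℚ k) ℚ.< ℕ→ℚ d)

-- s = ⌈ log_x d ⌉ for a natural number d ≥ 1 (so the value is ≥ 0):
-- s is the least integer with d ≤ x ^ s.
IsCeilLog : ℝ → ℕ → ℕ → Set
IsCeilLog x d s = LeqPow x d s × (∀ t → t ℕ.< s → ¬ LeqPow x d t)

-- Triangulations of the convex n-gon with vertices 0,…,n-1.
-- An edge is a pair (i , j) with i < j.

Edge : Set
Edge = ℕ × ℕ

IsDiagonal : ℕ → Edge → Set
IsDiagonal n (i , j) = suc i ℕ.< j × j ℕ.< n × ¬ (i ≡ 0 × suc j ≡ n)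

Cross : Edge → Edge → Set
Cross (a , b) (c , d) = (a ℕ.< c × c ℕ.< b × b ℕ.< d) ⊎ (c ℕ.< a × a ℕ.< d × d ℕ.< b)

record IsTriangulation (n : ℕ) (D : List Edge) : Set where
  field
    unique     : Unique D
    diagonals  : ∀ {e} → e ∈ D → IsDiagonal n e
    noncross   : ∀ {e f} → e ∈ D → f ∈ D → ¬ Cross e f
    maximal    : ∀ e → IsDiagonal n e → ¬ (e ∈ D) → ∃ λ f → f ∈ D × Cross e f

edgeEqᵇ : Edge → Edge → Bool
edgeEqᵇ (a , b) (c , d) = (a ≡ᵇ c) ∧ (b ≡ᵇ d)

memᵇ : Edge → List Edge → Bool
memᵇ e []      = false
memᵇ e (f ∷ D) = if edgeEqᵇ e f then true else memᵇ e D

boundaryᵇ : ℕ → Edge → Bool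
boundaryᵇ n (i , j) = (suc i ≡ᵇ j) ∨' ((i ≡ᵇ 0) ∧ (suc j ≡ᵇ n))
  where
  _∨'_ : Bool → Bool → Bool
  true  ∨' _ = true
  false ∨' b = b

isEdgeᵇ : ℕ → List Edge → Edge → Bool
isEdgeᵇ n D e = if boundaryᵇ n e then true else memᵇ e D

Triple : Set
Triple = ℕ × ℕ × ℕ

allTriples : ℕ → List Triple
allTriples n =
  concatMap (λ c → concatMap (λ b → map (λ a → a , b , c) (upTo b)) (upTo c)) (upTo n)

triangles : ℕ → List Edge → List Triple
triangles n D = filterᵇ isTri (allTriples n)
  where
  isTri : Triple → Bool
  isTri (a , b , c) = isEdgeᵇ n D (a , b) ∧ isEdgeᵇ n D (b , c) ∧ isEdgeᵇ n D (a , c)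

-- Triangle types w.r.t. a scale function σ, where the scale of the
-- edge UV is σ |U - V|.  For a < b < c: sAB = σ (b ∸ a), etc.

_≠ᵇ_ : ℕ → ℕ → Bool
x ≠ᵇ y = not (x ≡ᵇ y)

typeLᵇ typeMᵇ typeRᵇ typeZᵇ : (ℕ → ℕ) → Triple → Bool
typeLᵇ σ (a , b , c) = (σ (b ∸ a) ≠ᵇ σ (c ∸ b)) ∧ (σ (c ∸ b) ≡ᵇ σ (c ∸ a))
typeMᵇ σ (a , b , c) = (σ (c ∸ b) ≠ᵇ σ (b ∸ a)) ∧ (σ (b ∸ a) ≡ᵇ σ (c ∸ a))
typeRᵇ σ (a , b , c) = (σ (c ∸ a) ≠ᵇ σ (b ∸ a)) ∧ (σ (b ∸ a) ≡ᵇ σ (c ∸ b))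
typeZᵇ σ (a , b , c) = (σ (b ∸ a) ≡ᵇ σ (c ∸ b)) ∧ (σ (c ∸ b) ≡ᵇ σ (c ∸ a))

typeCounts : (ℕ → ℕ) → ℕ → List Edge → ℕ × ℕ × ℕ × ℕ
typeCounts σ n D =
  length (filterᵇ (typeLᵇ σ) ts) , length (filterᵇ (typeMᵇ σ) ts) ,
  length (filterᵇ (typeRᵇ σ) ts) , length (filterᵇ (typeZᵇ σ) ts)
  where ts = triangles n D

flipTo : Edge → Edge → List Edge → List Edge
flipTo e f D = f ∷ filterᵇ (λ g → not (edgeEqᵇ g e)) D

-- Flipping AC into BD replaces the triangles ABC, ACD by ABD, BCD and keeps every other
-- triangle, so equal type counts would make the two pairs of types {ABC, ACD} and {ABD, BCD}
-- equal as multisets. Let a, b, c, d be the scales of AB, BC, CD, AD and p, q those of AC, BD.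
-- Monotonicity of the scale gives b < p, b < q (using b ≠ p, q), a ≤ p ≤ d and c ≤ q ≤ d, and
-- r ≥ 3 gives d ≤ k as soon as a, b, c < k, since AD = AB + BC + CD. Running through the
-- possible types, these constraints and p ≠ q rule out both ways of matching the two pairs.

module Submission where

open import Defs
open import Data.Nat as ℕ using (ℕ; zero; suc; _+_; _∸_; _≤_; _<_; z≤n; s≤s; _≡ᵇ_; _≟_)
import Data.Nat.Properties as ℕ
import Data.Integer as ℤ
import Data.Integer.Properties as ℤ
open import Data.Rational as ℚ using (ℚ; mkℚ; 1ℚ)
import Data.Rational.Properties as ℚ
import Data.Nat.Coprimality as Coprime
open import Data.Bool using (Bool; true; false; _∧_; not; T; if_then_else_)
open import Data.Unit using (tt)
open import Data.Empty using (⊥; ⊥-elim)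
open import Data.Product using (_×_; _,_; proj₁; proj₂; ∃)
open import Data.Product.Properties using (,-injective; ≡-dec)
open import Data.Sum using (_⊎_; inj₁; inj₂; swap; [_,_])
open import Data.List using (List; []; _∷_; _++_; map; concatMap; upTo; filterᵇ; length)
open import Data.List.Membership.Propositional using (_∈_)
open import Data.List.Membership.Propositional.Properties using (∈-upTo⁺; ∈-upTo⁻; ∈-filter⁺; ∈-filter⁻)
open import Data.List.Relation.Unary.Any using (here; there)
import Data.List.Relation.Unary.All as All
open import Data.List.Relation.Unary.AllPairs using (_∷_)
open import Data.List.Relation.Unary.Unique.Propositional using (Unique)
open import Data.List.Relation.Unary.Unique.Propositional.Properties using (upTo⁺)
open import Algebra.Properties.CommutativeSemigroup ℕ.+-commutativeSemigroup using (interchange)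
open import Function using (_∘′_)
open import Function.Bundles using (mk⇔)
open import Relation.Nullary using (¬_; Dec; does; proof; map′; yes; no; _×-dec_)
open import Relation.Nullary.Decidable using (dec-true; dec-false; does-⇔; T?)
open import Relation.Nullary.Reflects using (Reflects; ofʸ; ofⁿ)
open import Relation.Binary.Definitions using (DecidableEquality; tri<; tri≈; tri>)
open import Relation.Binary.PropositionalEquality
  using (_≡_; _≢_; refl; sym; trans; cong; cong₂; subst; subst₂; ≢-sym; module ≡-Reasoning)

-- Sums over lists

⟦_⟧ : Bool → ℕ
⟦ b ⟧ = if b then 1 else 0

∑ : {A : Set} → List A → (A → ℕ) → ℕ
∑ []       f = 0
∑ (x ∷ xs) f = f x + ∑ xs f

module _ {A : Set} where

  ∑-cong : ∀ {f g : A → ℕ} xs → (∀ {x} → x ∈ xs → f x ≡ g x) → ∑ xs f ≡ ∑ xs g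
  ∑-cong []       _     = refl
  ∑-cong (x ∷ xs) f≡g = cong₂ _+_ (f≡g (here refl)) (∑-cong xs (f≡g ∘′ there))

  ∑-zero : ∀ {f : A → ℕ} xs → (∀ {x} → x ∈ xs → f x ≡ 0) → ∑ xs f ≡ 0
  ∑-zero []       _   = refl
  ∑-zero (x ∷ xs) f≡0 = cong₂ _+_ (f≡0 (here refl)) (∑-zero xs (f≡0 ∘′ there))

  ∑-+ : ∀ (f g : A → ℕ) xs → ∑ xs (λ x → f x + g x) ≡ ∑ xs f + ∑ xs g
  ∑-+ f g []       = refl
  ∑-+ f g (x ∷ xs) = trans (cong (f x + g x +_) (∑-+ f g xs)) (interchange (f x) (g x) (∑ xs f) (∑ xs g))

  ∑-+₃ : ∀ (f g h : A → ℕ) xs → ∑ xs (λ x → f x + (g x + h x)) ≡ ∑ xs f + (∑ xs g + ∑ xs h)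
  ∑-+₃ f g h xs = trans (∑-+ f _ xs) (cong (∑ xs f +_) (∑-+ g h xs))

  ∑-++ : ∀ (f : A → ℕ) xs ys → ∑ (xs ++ ys) f ≡ ∑ xs f + ∑ ys f
  ∑-++ f []       ys = refl
  ∑-++ f (x ∷ xs) ys = trans (cong (f x +_) (∑-++ f xs ys)) (sym (ℕ.+-assoc (f x) (∑ xs f) (∑ ys f)))

  ∑-single : ∀ {f : A → ℕ} {k xs} → Unique xs → k ∈ xs → (∀ x → x ≢ k → f x ≡ 0) →
    ∑ xs f ≡ f k
  ∑-single {f} {k} {k ∷ xs} (k∉xs ∷ _) (here refl) f≡0 = trans
    (cong (f k +_) (∑-zero xs λ x∈xs → f≡0 _ (≢-sym (All.lookup k∉xs x∈xs))))
    (ℕ.+-identityʳ (f k))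
  ∑-single (x∉xs ∷ uniq) (there k∈xs) f≡0 =
    cong₂ _+_ (f≡0 _ (All.lookup x∉xs k∈xs)) (∑-single uniq k∈xs f≡0)

∑-map : ∀ {A B : Set} (f : B → ℕ) (h : A → B) xs → ∑ (map h xs) f ≡ ∑ xs (λ x → f (h x))
∑-map f h []       = refl
∑-map f h (x ∷ xs) = cong (f (h x) +_) (∑-map f h xs)

∑-concatMap : ∀ {A B : Set} (f : B → ℕ) (h : A → List B) xs →
  ∑ (concatMap h xs) f ≡ ∑ xs (λ x → ∑ (h x) f)
∑-concatMap f h []       = refl
∑-concatMap f h (x ∷ xs) = trans (∑-++ f (h x) (concatMap h xs)) (cong (∑ (h x) f +_) (∑-concatMap f h xs))

length-filterᵇ-filterᵇ : ∀ {A : Set} (f g : A → Bool) xs →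
  length (filterᵇ f (filterᵇ g xs)) ≡ ∑ xs (λ x → ⟦ g x ∧ f x ⟧)
length-filterᵇ-filterᵇ f g [] = refl
length-filterᵇ-filterᵇ f g (x ∷ xs) with g x
... | false = length-filterᵇ-filterᵇ f g xs
... | true with f x
...   | true  = cong suc (length-filterᵇ-filterᵇ f g xs)
...   | false = length-filterᵇ-filterᵇ f g xs

module _ {n : ℕ} where

  ∑-allTriples : ∀ {f : Triple → ℕ} →
    ∑ (allTriples n) f ≡ ∑ (upTo n) λ c → ∑ (upTo c) λ b → ∑ (upTo b) λ a → f (a , b , c)
  ∑-allTriples {f} = trans (∑-concatMap f _ (upTo n)) (∑-cong (upTo n) λ {c} _ →
    trans (∑-concatMap f _ (upTo c)) (∑-cong (upTo c) λ {b} _ → ∑-map f _ (upTo b)))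

  ∑-allTriples-cong : ∀ {f g : Triple → ℕ} →
    (∀ {a b c} → a < b → b < c → c < n → f (a , b , c) ≡ g (a , b , c)) →
    ∑ (allTriples n) f ≡ ∑ (allTriples n) g
  ∑-allTriples-cong f≡g = trans ∑-allTriples (trans
    (∑-cong (upTo n) λ c<n → ∑-cong _ λ b<c → ∑-cong _ λ a<b →
       f≡g (∈-upTo⁻ a<b) (∈-upTo⁻ b<c) (∈-upTo⁻ c<n))
    (sym ∑-allTriples))

  ∑-allTriples-single : ∀ {f : Triple → ℕ} {x y z} → x < y → y < z → z < n →
    (∀ t → t ≢ (x , y , z) → f t ≡ 0) → ∑ (allTriples n) f ≡ f (x , y , z)
  ∑-allTriples-single {f} {x} {y} {z} x<y y<z z<n f≡0 = begin
    ∑ (allTriples n) f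
      ≡⟨ ∑-allTriples ⟩
    ∑ (upTo n) (λ c → ∑ (upTo c) λ b → ∑ (upTo b) λ a → f (a , b , c))
      ≡⟨ ∑-single (upTo⁺ n) (∈-upTo⁺ z<n) (λ c c≢z → ∑-zero (upTo c) λ {b} _ → ∑-zero (upTo b) λ {a} _ →
           f≡0 (a , b , c) (c≢z ∘′ cong (proj₂ ∘′ proj₂))) ⟩
    ∑ (upTo z) (λ b → ∑ (upTo b) λ a → f (a , b , z))
      ≡⟨ ∑-single (upTo⁺ z) (∈-upTo⁺ y<z) (λ b b≢y → ∑-zero (upTo b) λ {a} _ →
           f≡0 (a , b , z) (b≢y ∘′ cong (proj₁ ∘′ proj₂))) ⟩
    ∑ (upTo y) (λ a → f (a , y , z))
      ≡⟨ ∑-single (upTo⁺ y) (∈-upTo⁺ x<y) (λ a a≢x → f≡0 _ (a≢x ∘′ cong proj₁)) ⟩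
    f (x , y , z) ∎
    where open ≡-Reasoning

_≟ₜ_ : DecidableEquality Triple
_≟ₜ_ = ≡-dec _≟_ (≡-dec _≟_ _≟_)

∑-point : ∀ {n} (f : Triple → Bool) {x y z} → x < y → y < z → z < n →
  ∑ (allTriples n) (λ t → ⟦ does (t ≟ₜ (x , y , z)) ∧ f t ⟧) ≡ ⟦ f (x , y , z) ⟧
∑-point f {x} {y} {z} x<y y<z z<n = trans (∑-allTriples-single x<y y<z z<n vanish) at-point
  where
  vanish : ∀ t → t ≢ (x , y , z) → ⟦ does (t ≟ₜ (x , y , z)) ∧ f t ⟧ ≡ 0
  vanish t t≢xyz rewrite dec-false (t ≟ₜ (x , y , z)) t≢xyz = refl
  at-point : ⟦ does ((x , y , z) ≟ₜ (x , y , z)) ∧ f (x , y , z) ⟧ ≡ ⟦ f (x , y , z) ⟧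
  at-point rewrite dec-true ((x , y , z) ≟ₜ (x , y , z)) refl = refl

module _ {A : Set} (_≟ᴬ_ : DecidableEquality A) where

  δ : A → A → ℕ
  δ x y = ⟦ does (x ≟ᴬ y) ⟧

  δ-refl : ∀ x → δ x x ≡ 1
  δ-refl x rewrite dec-true (x ≟ᴬ x) refl = refl

  δ≢0⇒≡ : ∀ {x y} → δ x y ≢ 0 → x ≡ y
  δ≢0⇒≡ {x} {y} δ≢0 with x ≟ᴬ y
  ... | yes x≡y = x≡y
  ... | no  _   = ⊥-elim (δ≢0 refl)

  ≡-from-δ : ∀ {x y} → (∀ a → δ a x ≡ δ a y) → x ≡ y
  ≡-from-δ {x} h = δ≢0⇒≡ (λ δxy≡0 → ℕ.1+n≢0 (trans (sym (δ-refl x)) (trans (h x) δxy≡0)))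

  private
    ≡-second : ∀ {x₁ x₂ y₁ y₂} → δ x₁ x₁ + δ x₁ x₂ ≡ δ x₁ y₁ + δ x₁ y₂ → x₁ ≢ y₁ →
      x₁ ≡ y₂
    ≡-second {x₁} {x₂} {y₁} {y₂} h x₁≢y₁ = δ≢0⇒≡ λ δx₁y₂≡0 → ℕ.1+n≢0 (begin
      1 + δ x₁ x₂          ≡⟨ cong (_+ δ x₁ x₂) (sym (δ-refl x₁)) ⟩
      δ x₁ x₁ + δ x₁ x₂    ≡⟨ h ⟩
      δ x₁ y₁ + δ x₁ y₂    ≡⟨ cong₂ _+_ (cong ⟦_⟧ (dec-false (x₁ ≟ᴬ y₁) x₁≢y₁)) δx₁y₂≡0 ⟩
      0                    ∎)
      where open ≡-Reasoning

  pair-≡-upTo-swap : ∀ {x₁ x₂ y₁ y₂} → (∀ a → δ a x₁ + δ a x₂ ≡ δ a y₁ + δ a y₂) →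
    (x₁ ≡ y₁ × x₂ ≡ y₂) ⊎ (x₁ ≡ y₂ × x₂ ≡ y₁)
  pair-≡-upTo-swap {x₁} {x₂} {y₁} {y₂} h with x₁ ≟ᴬ y₁
  ... | yes refl = inj₁ (refl , ≡-from-δ λ a → ℕ.+-cancelˡ-≡ (δ a x₁) _ _ (h a))
  ... | no x₁≢y₁ with refl ← ≡-second (h x₁) x₁≢y₁ =
    inj₂ (refl , ≡-from-δ λ a → ℕ.+-cancelˡ-≡ (δ a x₁) _ _ (trans (h a) (ℕ.+-comm (δ a y₁) (δ a x₁))))

-- Types of triangles

data TriangleType : Set where
  type-l type-m type-r type-z type-none : TriangleType

-- HasType u v w t: t is the type of a triangle A < B < C whose sides AB, BC, AC have scales u, v, w;
-- type-none (three distinct scales) is not one of the paper's types.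
data HasType : ℕ → ℕ → ℕ → TriangleType → Set where
  has-l : ∀ {u v} → u ≢ v → HasType u v v type-l
  has-m : ∀ {u v} → u ≢ v → HasType u v u type-m
  has-r : ∀ {u w} → u ≢ w → HasType u u w type-r
  has-z : ∀ {u} → HasType u u u type-z
  has-none : ∀ {u v w} → u ≢ v → v ≢ w → u ≢ w → HasType u v w type-none

hasType : ∀ u v w → ∃ (HasType u v w)
hasType u v w with u ≟ v | v ≟ w | u ≟ w
... | yes refl | yes refl | _        = type-z , has-z
... | yes refl | no v≢w   | _        = type-r , has-r v≢w
... | no u≢v   | yes refl | _        = type-l , has-l u≢v
... | no u≢v   | no v≢w   | yes refl = type-m , has-m u≢v
... | no u≢v   | no v≢w   | no u≢w   = type-none , has-none u≢v v≢w u≢w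

TriangleHasType : (ℕ → ℕ) → Triple → TriangleType → Set
TriangleHasType σ (a , b , c) = HasType (σ (b ∸ a)) (σ (c ∸ b)) (σ (c ∸ a))

triangleType : ∀ σ t → ∃ (TriangleHasType σ t)
triangleType σ (a , b , c) = hasType _ _ _

_==_ : TriangleType → TriangleType → Bool
type-l == type-l = true
type-m == type-m = true
type-r == type-r = true
type-z == type-z = true
type-none == type-none = true
_ == _ = false

_≟ᵀ_ : DecidableEquality TriangleType
s ≟ᵀ t = map′ (sound s t) complete (T? (s == t))
  where
  sound : ∀ s t → T (s == t) → s ≡ t
  sound type-l type-l _ = refl
  sound type-m type-m _ = refl
  sound type-r type-r _ = refl
  sound type-z type-z _ = refl
  sound type-none type-none _ = refl
  complete : ∀ {s t} → s ≡ t → T (s == t)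
  complete {type-l} refl = tt
  complete {type-m} refl = tt
  complete {type-r} refl = tt
  complete {type-z} refl = tt
  complete {type-none} refl = tt

-- (typeLᵇ σ t , typeMᵇ σ t , typeRᵇ σ t , typeZᵇ σ t) as a function of the scales of t
typeFlags : ℕ → ℕ → ℕ → Bool × Bool × Bool × Bool
typeFlags u v w =
  not (u ≡ᵇ v) ∧ (v ≡ᵇ w) , not (v ≡ᵇ u) ∧ (u ≡ᵇ w) ,
  not (w ≡ᵇ u) ∧ (u ≡ᵇ v) , (u ≡ᵇ v) ∧ (v ≡ᵇ w)

scaleFlags : (ℕ → ℕ) → Triple → Bool × Bool × Bool × Bool
scaleFlags σ (a , b , c) = typeFlags (σ (b ∸ a)) (σ (c ∸ b)) (σ (c ∸ a))

flags : TriangleType → Bool × Bool × Bool × Bool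
flags t = type-l == t , type-m == t , type-r == t , type-z == t

≡ᵇ-refl : ∀ u → (u ≡ᵇ u) ≡ true
≡ᵇ-refl u = dec-true (u ≟ u) refl

≢⇒≡ᵇ-false : ∀ {u v} → u ≢ v → (u ≡ᵇ v) ≡ false
≢⇒≡ᵇ-false {u} {v} = dec-false (u ≟ v)

typeFlags-HasType : ∀ {u v w t} → HasType u v w t → typeFlags u v w ≡ flags t
typeFlags-HasType {u} {v} (has-l u≢v)
  rewrite ≢⇒≡ᵇ-false u≢v | ≢⇒≡ᵇ-false (≢-sym u≢v) | ≡ᵇ-refl v = refl
typeFlags-HasType {u} {v} (has-m u≢v)
  rewrite ≢⇒≡ᵇ-false u≢v | ≢⇒≡ᵇ-false (≢-sym u≢v) | ≡ᵇ-refl u = refl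
typeFlags-HasType {u} {_} {w} (has-r u≢w)
  rewrite ≢⇒≡ᵇ-false u≢w | ≢⇒≡ᵇ-false (≢-sym u≢w) | ≡ᵇ-refl u = refl
typeFlags-HasType {u} has-z rewrite ≡ᵇ-refl u = refl
typeFlags-HasType (has-none u≢v v≢w u≢w)
  rewrite ≢⇒≡ᵇ-false u≢v | ≢⇒≡ᵇ-false v≢w | ≢⇒≡ᵇ-false u≢w
        | ≢⇒≡ᵇ-false (≢-sym u≢v) | ≢⇒≡ᵇ-false (≢-sym u≢w) = refl

δᵀ : TriangleType → TriangleType → ℕ
δᵀ = δ _≟ᵀ_

properTypes : List TriangleType
properTypes = type-l ∷ type-m ∷ type-r ∷ type-z ∷ []

δᵀ-partition : ∀ t → δᵀ type-none t + ∑ properTypes (λ X → δᵀ X t) ≡ 1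
δᵀ-partition type-l = refl
δᵀ-partition type-m = refl
δᵀ-partition type-r = refl
δᵀ-partition type-z = refl
δᵀ-partition type-none = refl

-- every triangle has exactly one type, so the multiplicities of type-none are determined by the others
δᵀ-pairs-from-proper : ∀ {t₁ t₂ t₃ t₄} →
  (∀ {X} → X ∈ properTypes → δᵀ X t₁ + δᵀ X t₂ ≡ δᵀ X t₃ + δᵀ X t₄) →
  ∀ X → δᵀ X t₁ + δᵀ X t₂ ≡ δᵀ X t₃ + δᵀ X t₄
δᵀ-pairs-from-proper h type-l = h (here refl)
δᵀ-pairs-from-proper h type-m = h (there (here refl))
δᵀ-pairs-from-proper h type-r = h (there (there (here refl)))
δᵀ-pairs-from-proper h type-z = h (there (there (there (here refl))))
δᵀ-pairs-from-proper {t₁} {t₂} {t₃} {t₄} h type-none = ℕ.+-cancelʳ-≡ _ _ _ (begin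
  none₁₂ + ∑ properTypes (count t₁ t₂) ≡⟨ pair-total t₁ t₂ ⟩
  2                                   ≡⟨ pair-total t₃ t₄ ⟨
  none₃₄ + ∑ properTypes (count t₃ t₄) ≡⟨ cong (none₃₄ +_) (∑-cong properTypes h) ⟨
  none₃₄ + ∑ properTypes (count t₁ t₂) ∎)
  where
  open ≡-Reasoning
  count : TriangleType → TriangleType → TriangleType → ℕ
  count t t′ X = δᵀ X t + δᵀ X t′
  none₁₂ = count t₁ t₂ type-none
  none₃₄ = count t₃ t₄ type-none
  pair-total : ∀ t t′ → count t t′ type-none + ∑ properTypes (count t t′) ≡ 2
  pair-total t t′ = trans (cong (count t t′ type-none +_) (∑-+ (λ X → δᵀ X t) (λ X → δᵀ X t′) properTypes))
    (trans (interchange (δᵀ type-none t) (δᵀ type-none t′) _ _) (cong₂ _+_ (δᵀ-partition t) (δᵀ-partition t′)))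

flags-pair : ∀ (π : Bool × Bool × Bool × Bool → Bool) {u v w u′ v′ w′ t t′} →
  HasType u v w t → HasType u′ v′ w′ t′ →
  ⟦ π (typeFlags u v w) ⟧ + ⟦ π (typeFlags u′ v′ w′) ⟧ ≡ ⟦ π (flags t) ⟧ + ⟦ π (flags t′) ⟧
flags-pair π h h′ =
  cong₂ _+_ (cong (λ fs → ⟦ π fs ⟧) (typeFlags-HasType h)) (cong (λ fs → ⟦ π fs ⟧) (typeFlags-HasType h′))

-- The flip in terms of scales

-- scales of the sides AB, BC, CD, AD and of the diagonals AC, BD of a quadrilateral A < B < C < D
record QuadScales (a b c d p q : ℕ) : Set where
  field
    b<p : b < p
    b<q : b < q
    p≢q : p ≢ q
    a≤p : a ≤ p
    c≤q : c ≤ q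
    p≤d : p ≤ d
    q≤d : q ≤ d
    d≤  : ∀ {k} → a < k → b < k → c < k → d ≤ k

module _ {a b c d p q : ℕ} (S : QuadScales a b c d p q) where
  open QuadScales S

  -- if p < q then a, b, c < q, so the scale d of AD = AB + BC + CD is at most q; symmetrically if q < p
  some-scales-coincide : a ≢ p → p ≢ d → c ≢ q → q ≢ d → ⊥
  some-scales-coincide a≢p p≢d c≢q q≢d with ℕ.<-cmp p q
  ... | tri< p<q _ _ = q≢d (ℕ.≤-antisym q≤d
          (d≤ (ℕ.≤-<-trans a≤p p<q) b<q (ℕ.≤∧≢⇒< c≤q c≢q)))
  ... | tri≈ _ p≡q _ = p≢q p≡q
  ... | tri> _ _ q<p = p≢d (ℕ.≤-antisym p≤d
          (d≤ (ℕ.≤∧≢⇒< a≤p a≢p) b<p (ℕ.≤-<-trans c≤q q<p)))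

b<p-irrefl : ∀ {a b c d q} → ¬ QuadScales a b c d b q
b<p-irrefl S = ℕ.<-irrefl refl (QuadScales.b<p S)

b<q-irrefl : ∀ {a b c d p} → ¬ QuadScales a b c d p b
b<q-irrefl S = ℕ.<-irrefl refl (QuadScales.b<q S)

-- the scale triples a b p, p c d, a q d, b c q are those of ABC, ACD (before the flip) and ABD, BCD (after it)
types-not-preserved : ∀ {a b c d p q t₁ t₂} → QuadScales a b c d p q →
  HasType a b p t₁ → HasType p c d t₂ → HasType a q d t₁ → HasType b c q t₂ → ⊥
types-not-preserved S (has-l _) _ _ _ = b<p-irrefl S
types-not-preserved S has-z _ _ _ = b<p-irrefl S
types-not-preserved S (has-r _) _ (has-r _) _ = b<q-irrefl S
types-not-preserved S (has-m _) _ (has-m _) (has-m _) = b<q-irrefl S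
types-not-preserved S (has-m _) _ (has-m _) has-z = b<q-irrefl S
types-not-preserved S (has-m _) (has-l a≢a) (has-m _) (has-l _) = a≢a refl
types-not-preserved S (has-m _) (has-r a≢a) (has-m _) (has-r _) = a≢a refl
types-not-preserved S (has-m _) (has-none _ _ a≢a) (has-m _) (has-none _ _ _) = a≢a refl
types-not-preserved S (has-none _ _ _) _ (has-none _ _ _) (has-m _) = b<q-irrefl S
types-not-preserved S (has-none _ _ _) _ (has-none _ _ _) has-z = b<q-irrefl S
types-not-preserved S (has-none _ _ _) (has-l _) (has-none _ c≢c _) (has-l _) = c≢c refl
types-not-preserved S (has-none _ _ _) (has-r _) (has-none _ _ _) (has-r _) = b<p-irrefl S
types-not-preserved S (has-none _ _ a≢p) (has-none _ _ p≢d) (has-none _ q≢d _) (has-none _ c≢q _) =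
  some-scales-coincide S a≢p p≢d c≢q q≢d

types-not-swapped : ∀ {a b c d p q t₁ t₂} → QuadScales a b c d p q →
  HasType a b p t₁ → HasType p c d t₂ → HasType a q d t₂ → HasType b c q t₁ → ⊥
types-not-swapped S (has-l _) _ _ _ = b<p-irrefl S
types-not-swapped S has-z _ _ _ = b<p-irrefl S
types-not-swapped S (has-m _) _ _ (has-m _) = b<q-irrefl S
types-not-swapped S (has-r _) (has-l _) _ (has-r _) = ℕ.<⇒≱ (QuadScales.b<p S) (QuadScales.p≤d S)
types-not-swapped S (has-r _) (has-m _) (has-m _) (has-r _) = b<p-irrefl S
types-not-swapped S (has-r _) (has-r _) (has-r _) (has-r _) = b<p-irrefl S
types-not-swapped S (has-r _) has-z has-z (has-r _) = b<p-irrefl S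
types-not-swapped S (has-r _) (has-none _ _ p≢d) (has-none _ _ _) (has-r _) =
  p≢d (ℕ.≤-antisym p≤d (d≤ b<p b<p b<p))
  where open QuadScales S
types-not-swapped S (has-none _ _ _) (has-l _) (has-l _) (has-none _ c≢c _) = c≢c refl
types-not-swapped S (has-none _ _ a≢a) (has-m _) (has-m _) (has-none _ _ _) = a≢a refl
types-not-swapped S (has-none _ _ a≢p) (has-r _) (has-r _) (has-none _ _ _) =
  a≢p (ℕ.≤-antisym a≤p c≤q)
  where open QuadScales S
types-not-swapped S (has-none _ _ _) has-z has-z (has-none _ _ _) = QuadScales.p≢q S refl
types-not-swapped S (has-none _ _ a≢p) (has-none _ _ p≢d) (has-none _ q≢d _) (has-none _ c≢q _) =
  some-scales-coincide S a≢p p≢d c≢q q≢d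

flip-changes-types : ∀ {a b c d p q t₁ t₂ t₃ t₄} → QuadScales a b c d p q →
  HasType a b p t₁ → HasType p c d t₂ → HasType a q d t₃ → HasType b c q t₄ →
  ¬ ((t₁ ≡ t₃ × t₂ ≡ t₄) ⊎ (t₁ ≡ t₄ × t₂ ≡ t₃))
flip-changes-types S h₁ h₂ h₃ h₄ (inj₁ (refl , refl)) = types-not-preserved S h₁ h₂ h₃ h₄
flip-changes-types S h₁ h₂ h₃ h₄ (inj₂ (refl , refl)) = types-not-swapped S h₁ h₂ h₃ h₄

-- Scales as ceilings of logarithms

ℕ→ℚ-mkℚ : ∀ d → ℕ→ℚ d ≡ mkℚ (ℤ.+ d) 0 (Coprime.sym (Coprime.1-coprimeTo d))
ℕ→ℚ-mkℚ d = ℚ.normalize-coprime _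

ℕ→ℚ-mono-≤ : ∀ {d d′} → d ≤ d′ → ℕ→ℚ d ℚ.≤ ℕ→ℚ d′
ℕ→ℚ-mono-≤ {d} {d′} d≤d′ rewrite ℕ→ℚ-mkℚ d | ℕ→ℚ-mkℚ d′ =
  ℚ.*≤* (subst₂ ℤ._≤_ (sym (ℤ.*-identityʳ (ℤ.+ d))) (sym (ℤ.*-identityʳ (ℤ.+ d′))) (ℤ.+≤+ d≤d′))

ℕ→ℚ-homo-+ : ∀ d d′ → ℕ→ℚ (d + d′) ≡ ℕ→ℚ d ℚ.+ ℕ→ℚ d′
ℕ→ℚ-homo-+ d d′ rewrite ℕ→ℚ-mkℚ d | ℕ→ℚ-mkℚ d′ =
  ℚ./-cong (trans (ℤ.pos-+ d d′) (sym (cong₂ ℤ._+_ (ℤ.*-identityʳ (ℤ.+ d)) (ℤ.*-identityʳ (ℤ.+ d′))))) refl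

module _ {q : ℚ} (1≤q : 1ℚ ℚ.≤ q) where

  1≤^ℚ : ∀ k → 1ℚ ℚ.≤ q ^ℚ k
  ^ℚ-nonNeg : ∀ k → ℚ.NonNegative (q ^ℚ k)
  ^ℚ-≤-suc : ∀ k → q ^ℚ k ℚ.≤ q ^ℚ suc k

  1≤^ℚ zero = ℚ.≤-refl
  1≤^ℚ (suc k) = ℚ.≤-trans (1≤^ℚ k) (^ℚ-≤-suc k)

  ^ℚ-nonNeg k = ℚ.nonNegative (ℚ.≤-trans (ℚ.nonNegative⁻¹ 1ℚ) (1≤^ℚ k))

  ^ℚ-≤-suc k = subst (ℚ._≤ q ℚ.* q ^ℚ k) (ℚ.*-identityˡ (q ^ℚ k))
    (ℚ.*-monoʳ-≤-nonNeg (q ^ℚ k) {{^ℚ-nonNeg k}} 1≤q)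

  ^ℚ-monoʳ-≤ : ∀ {k m} → k ≤ m → q ^ℚ k ℚ.≤ q ^ℚ m
  ^ℚ-monoʳ-≤ {m = zero} z≤n = ℚ.≤-refl
  ^ℚ-monoʳ-≤ {m = suc m} k≤1+m with ℕ.m≤n⇒m<n∨m≡n k≤1+m
  ... | inj₁ (s≤s k≤m) = ℚ.≤-trans (^ℚ-monoʳ-≤ k≤m) (^ℚ-≤-suc m)
  ... | inj₂ refl = ℚ.≤-refl

∸-+-∸ : ∀ {i j k} → i ≤ j → j ≤ k → (j ∸ i) + (k ∸ j) ≡ k ∸ i
∸-+-∸ {i} {j} {k} i≤j j≤k = begin
  (j ∸ i) + (k ∸ j) ≡⟨ ℕ.+-comm (j ∸ i) (k ∸ j) ⟩
  (k ∸ j) + (j ∸ i) ≡⟨ ℕ.+-∸-assoc (k ∸ j) i≤j ⟨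
  (k ∸ j) + j ∸ i   ≡⟨ cong (_∸ i) (ℕ.m∸n+n≡m j≤k) ⟩
  k ∸ i             ∎
  where open ≡-Reasoning

module _ (x : ℝ) (x≥3 : AtLeast3 x) where

  upper-≥3 : ∀ {q} → U x q → ℕ→ℚ 3 ℚ.≤ q
  upper-≥3 xU = ℚ.≮⇒≥ (λ q<3 → x≥3 (U-up x xU q<3))

  upper-≥1 : ∀ {q} → U x q → 1ℚ ℚ.≤ q
  upper-≥1 xU = ℚ.≤-trans (ℕ→ℚ-mono-≤ {1} {3} (s≤s z≤n)) (upper-≥3 xU)

  LeqPow-monoʳ : ∀ {d k m} → k ≤ m → LeqPow x d k → LeqPow x d m
  LeqPow-monoʳ k≤m d≤xᵏ (q , xU , qᵐ<d) =
    d≤xᵏ (q , xU , ℚ.≤-<-trans (^ℚ-monoʳ-≤ (upper-≥1 xU) k≤m) qᵐ<d)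

  LeqPow-antiˡ : ∀ {d d′ k} → d ≤ d′ → LeqPow x d′ k → LeqPow x d k
  LeqPow-antiˡ d≤d′ d′≤xᵏ (q , xU , qᵏ<d) =
    d′≤xᵏ (q , xU , ℚ.<-≤-trans qᵏ<d (ℕ→ℚ-mono-≤ d≤d′))

  -- d₁ + d₂ + d₃ ≤ 3 xᵐ ≤ x^(m+1): this is where x ≥ 3 is needed
  LeqPow-+₃ : ∀ {d₁ d₂ d₃ m} → LeqPow x d₁ m → LeqPow x d₂ m → LeqPow x d₃ m →
    LeqPow x (d₁ + d₂ + d₃) (suc m)
  LeqPow-+₃ {d₁} {d₂} {d₃} {m} h₁ h₂ h₃ (q , xU , q¹⁺ᵐ<d) =
    ℚ.<-irrefl refl (ℚ.<-≤-trans q¹⁺ᵐ<d sum≤q¹⁺ᵐ)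
    where
    X = q ^ℚ m
    bound : ∀ {d} → LeqPow x d m → ℕ→ℚ d ℚ.≤ X
    bound h = ℚ.≮⇒≥ (λ X<d → h (q , xU , X<d))
    open ℚ.≤-Reasoning
    sum≤q¹⁺ᵐ : ℕ→ℚ (d₁ + d₂ + d₃) ℚ.≤ q ℚ.* X
    sum≤q¹⁺ᵐ = begin
      ℕ→ℚ (d₁ + d₂ + d₃)
        ≡⟨ trans (ℕ→ℚ-homo-+ (d₁ + d₂) d₃) (cong (ℚ._+ ℕ→ℚ d₃) (ℕ→ℚ-homo-+ d₁ d₂)) ⟩
      ℕ→ℚ d₁ ℚ.+ ℕ→ℚ d₂ ℚ.+ ℕ→ℚ d₃
        ≤⟨ ℚ.+-mono-≤ (ℚ.+-mono-≤ (bound {d₁} h₁) (bound {d₂} h₂)) (bound {d₃} h₃) ⟩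
      X ℚ.+ X ℚ.+ X
        ≡⟨ sym 3*X≡X+X+X ⟩
      ℕ→ℚ 3 ℚ.* X
        ≤⟨ ℚ.*-monoʳ-≤-nonNeg X {{^ℚ-nonNeg (upper-≥1 xU) m}} (upper-≥3 xU) ⟩
      q ℚ.* X ∎
      where
      3*X≡X+X+X : ℕ→ℚ 3 ℚ.* X ≡ X ℚ.+ X ℚ.+ X
      3*X≡X+X+X = begin-equality
        (1ℚ ℚ.+ 1ℚ ℚ.+ 1ℚ) ℚ.* X    ≡⟨ ℚ.*-distribʳ-+ X (1ℚ ℚ.+ 1ℚ) 1ℚ ⟩
        (1ℚ ℚ.+ 1ℚ) ℚ.* X ℚ.+ 1ℚ ℚ.* X ≡⟨ cong₂ ℚ._+_ (ℚ.*-distribʳ-+ X 1ℚ 1ℚ) (ℚ.*-identityˡ X) ⟩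
        1ℚ ℚ.* X ℚ.+ 1ℚ ℚ.* X ℚ.+ X  ≡⟨ cong (λ Y → Y ℚ.+ Y ℚ.+ X) (ℚ.*-identityˡ X) ⟩
        X ℚ.+ X ℚ.+ X ∎

  module _ {σ : ℕ → ℕ} (σ-ceilLog : ∀ d → 1 ≤ d → IsCeilLog x d (σ d)) where

    scale-least : ∀ {d s} → 1 ≤ d → LeqPow x d s → σ d ≤ s
    scale-least {d} 1≤d d≤xˢ = ℕ.≮⇒≥ (λ s<σd → proj₂ (σ-ceilLog d 1≤d) _ s<σd d≤xˢ)

    scale-mono-≤ : ∀ {d d′} → 1 ≤ d → d ≤ d′ → σ d ≤ σ d′
    scale-mono-≤ {d} {d′} 1≤d d≤d′ =
      scale-least 1≤d (LeqPow-antiˡ {d} {d′} {σ d′} d≤d′ (proj₁ (σ-ceilLog _ (ℕ.≤-trans 1≤d d≤d′))))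

    scale-+₃ : ∀ {d₁ d₂ d₃ k} → 1 ≤ d₁ → 1 ≤ d₂ → 1 ≤ d₃ →
      σ d₁ < k → σ d₂ < k → σ d₃ < k → σ (d₁ + d₂ + d₃) ≤ k
    scale-+₃ {d₁} {d₂} {d₃} {suc m} 1≤d₁ 1≤d₂ 1≤d₃ (s≤s σ₁≤m) (s≤s σ₂≤m) (s≤s σ₃≤m) =
      scale-least (ℕ.≤-trans 1≤d₁ (ℕ.≤-trans (ℕ.m≤m+n d₁ d₂) (ℕ.m≤m+n (d₁ + d₂) _)))
        (LeqPow-+₃ {d₁} {d₂} {d₃} {m} (below 1≤d₁ σ₁≤m) (below 1≤d₂ σ₂≤m) (below 1≤d₃ σ₃≤m))
      where
      below : ∀ {d} → 1 ≤ d → σ d ≤ m → LeqPow x d m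
      below {d} 1≤d σd≤m = LeqPow-monoʳ {d} σd≤m (proj₁ (σ-ceilLog d 1≤d))

    quad-scales : ∀ {A B C D′} → A < B → B < C → C < D′ →
      σ (C ∸ A) ≢ σ (D′ ∸ B) → σ (D′ ∸ B) ≢ σ (C ∸ B) → σ (C ∸ A) ≢ σ (C ∸ B) →
      QuadScales (σ (B ∸ A)) (σ (C ∸ B)) (σ (D′ ∸ C)) (σ (D′ ∸ A)) (σ (C ∸ A)) (σ (D′ ∸ B))
    quad-scales {A} {B} {C} {D′} A<B B<C C<D′ p≢q q≢b p≢b = record
      { b<p = ℕ.≤∧≢⇒< (scale-mono-≤ (gap B<C) (ℕ.∸-monoʳ-≤ C A≤B)) (≢-sym p≢b)
      ; b<q = ℕ.≤∧≢⇒< (scale-mono-≤ (gap B<C) (ℕ.∸-monoˡ-≤ B C≤D′)) (≢-sym q≢b)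
      ; p≢q = p≢q
      ; a≤p = scale-mono-≤ (gap A<B) (ℕ.∸-monoˡ-≤ A B≤C)
      ; c≤q = scale-mono-≤ (gap C<D′) (ℕ.∸-monoʳ-≤ D′ B≤C)
      ; p≤d = scale-mono-≤ (gap (ℕ.<-trans A<B B<C)) (ℕ.∸-monoˡ-≤ A C≤D′)
      ; q≤d = scale-mono-≤ (gap (ℕ.<-trans B<C C<D′)) (ℕ.∸-monoʳ-≤ D′ A≤B)
      ; d≤  = λ {k} a<k b<k c<k → subst (λ AD′ → σ AD′ ≤ k) AD′≡AB+BC+CD′
                (scale-+₃ (gap A<B) (gap B<C) (gap C<D′) a<k b<k c<k)
      }
      where
      gap : ∀ {i j} → i < j → 1 ≤ j ∸ i
      gap = ℕ.m<n⇒0<n∸m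
      A≤B = ℕ.<⇒≤ A<B
      B≤C = ℕ.<⇒≤ B<C
      C≤D′ = ℕ.<⇒≤ C<D′
      AD′≡AB+BC+CD′ : (B ∸ A) + (C ∸ B) + (D′ ∸ C) ≡ D′ ∸ A
      AD′≡AB+BC+CD′ =
        trans (cong (_+ (D′ ∸ C)) (∸-+-∸ A≤B B≤C)) (∸-+-∸ (ℕ.≤-trans A≤B B≤C) C≤D′)

_≟ₑ_ : DecidableEquality Edge
(a , b) ≟ₑ (c , d) = map′ (λ (a≡c , b≡d) → cong₂ _,_ a≡c b≡d) ,-injective (a ≟ c ×-dec b ≟ d)

memᵇ-reflects : ∀ e ds → Reflects (e ∈ ds) (memᵇ e ds)
memᵇ-reflects e [] = ofⁿ λ ()
memᵇ-reflects e (f ∷ ds) with edgeEqᵇ e f | proof (e ≟ₑ f)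
... | true  | ofʸ refl = ofʸ (here refl)
... | false | ofⁿ e≢f with memᵇ e ds | memᵇ-reflects e ds
...   | true  | ofʸ e∈ds = ofʸ (there e∈ds)
...   | false | ofⁿ e∉ds = ofⁿ λ { (here e≡f) → e≢f e≡f ; (there e∈ds) → e∉ds e∈ds }

IsBoundary : ℕ → Edge → Set
IsBoundary n (i , j) = suc i ≡ j ⊎ (i ≡ 0 × suc j ≡ n)

IsEdge : ℕ → List Edge → Edge → Set
IsEdge n ds e = IsBoundary n e ⊎ e ∈ ds

IsTriangle : ℕ → List Edge → Triple → Set
IsTriangle n ds (x , y , z) = IsEdge n ds (x , y) × IsEdge n ds (y , z) × IsEdge n ds (x , z)

boundary? : ∀ n e → Dec (IsBoundary n e)
does  (boundary? n (i , j)) = boundaryᵇ n (i , j)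
proof (boundary? n (i , j)) with suc i ≡ᵇ j | proof (suc i ≟ j)
... | true  | ofʸ i+1≡j = ofʸ (inj₁ i+1≡j)
... | false | ofⁿ i+1≢j with (i ≡ᵇ 0) ∧ (suc j ≡ᵇ n) | proof (i ≟ 0 ×-dec suc j ≟ n)
...   | true  | ofʸ ends = ofʸ (inj₂ ends)
...   | false | ofⁿ ¬ends = ofⁿ λ { (inj₁ i+1≡j) → i+1≢j i+1≡j ; (inj₂ ends) → ¬ends ends }

edge? : ∀ n ds e → Dec (IsEdge n ds e)
does  (edge? n ds e) = isEdgeᵇ n ds e
proof (edge? n ds e) with boundaryᵇ n e | proof (boundary? n e)
... | true  | ofʸ e-bd = ofʸ (inj₁ e-bd)
... | false | ofⁿ ¬e-bd with memᵇ e ds | memᵇ-reflects e ds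
...   | true  | ofʸ e∈ds = ofʸ (inj₂ e∈ds)
...   | false | ofⁿ e∉ds = ofⁿ λ { (inj₁ e-bd) → ¬e-bd e-bd ; (inj₂ e∈ds) → e∉ds e∈ds }

triangle? : ∀ n ds t → Dec (IsTriangle n ds t)
triangle? n ds (x , y , z) = edge? n ds (x , y) ×-dec edge? n ds (y , z) ×-dec edge? n ds (x , z)

does-true⇒ : ∀ {P : Set} (P? : Dec P) → does P? ≡ true → P
does-true⇒ (yes p) _ = p

Cross-sym : ∀ {e f} → Cross e f → Cross f e
Cross-sym = swap

boundary-noncrossing : ∀ {n e f} → IsBoundary n e → proj₂ f < n → ¬ Cross e f
boundary-noncrossing (inj₁ refl) _ (inj₁ (i<c , c<i+1 , _)) = ℕ.<⇒≱ i<c (ℕ.≤-pred c<i+1)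
boundary-noncrossing (inj₁ refl) _ (inj₂ (_ , i<d , d<i+1)) = ℕ.<⇒≱ i<d (ℕ.≤-pred d<i+1)
boundary-noncrossing (inj₂ (refl , refl)) d<n (inj₁ (_ , _ , j<d)) = ℕ.<⇒≱ j<d (ℕ.≤-pred d<n)

edges-noncrossing : ∀ {n ds e f} → IsTriangulation n ds → proj₂ e < n → proj₂ f < n →
  IsEdge n ds e → IsEdge n ds f → ¬ Cross e f
edges-noncrossing _ _ f<n (inj₁ e-bd) _ = boundary-noncrossing e-bd f<n
edges-noncrossing _ e<n _ (inj₂ _) (inj₁ f-bd) = boundary-noncrossing f-bd e<n ∘′ Cross-sym
edges-noncrossing tri _ _ (inj₂ e∈ds) (inj₂ f∈ds) = IsTriangulation.noncross tri e∈ds f∈ds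

diagonal-not-boundary : ∀ {n e} → IsDiagonal n e → ¬ IsBoundary n e
diagonal-not-boundary (i+1<j , _ , _) (inj₁ refl) = ℕ.<-irrefl refl i+1<j
diagonal-not-boundary (_ , _ , not-ends) (inj₂ ends) = not-ends ends

∈-flipTo⁺ : ∀ {e f g ds} → e ≢ f → e ∈ ds → e ∈ flipTo f g ds
∈-flipTo⁺ {e} {f} e≢f e∈ds = there (∈-filter⁺ (λ h → T? (not (edgeEqᵇ h f))) e∈ds e-kept)
  where
  e-kept : T (not (edgeEqᵇ e f))
  e-kept rewrite dec-false (e ≟ₑ f) e≢f = tt

∈-flipTo⁻ : ∀ {e f g ds} → e ∈ flipTo f g ds → e ≡ g ⊎ (e ∈ ds × e ≢ f)
∈-flipTo⁻ (here e≡g) = inj₁ e≡g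
∈-flipTo⁻ {e} {f} (there e∈filter) with ∈-filter⁻ (λ h → T? (not (edgeEqᵇ h f))) e∈filter
... | e∈ds , e-kept = inj₂ (e∈ds , λ { refl → subst (T ∘′ not) (dec-true (e ≟ₑ e) refl) e-kept })

-- Flipping a diagonal

Side : Edge → Triple → Set
Side e (x , y , z) = e ≡ (x , y) ⊎ e ≡ (y , z) ⊎ e ≡ (x , z)

module Flip {n : ℕ} {D : List Edge} (tri : IsTriangulation n D)
  {A B C D′ : ℕ} (A<B : A < B) (B<C : B < C) (C<D′ : C < D′) (D′<n : D′ < n) (AC∈D : (A , C) ∈ D)
  (AB : IsEdge n D (A , B)) (BC : IsEdge n D (B , C)) (CD′ : IsEdge n D (C , D′)) (AD′ : IsEdge n D (A , D′))
  where

  D₂ : List Edge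
  D₂ = flipTo (A , C) (B , D′) D

  private
    A<C = ℕ.<-trans A<B B<C
    B<D′ = ℕ.<-trans B<C C<D′
    C<n = ℕ.<-trans C<D′ D′<n
    B<n = ℕ.<-trans B<C C<n

    crossing : ∀ {e f} → proj₂ e < n → proj₂ f < n → IsEdge n D e → IsEdge n D f → ¬ Cross e f
    crossing = edges-noncrossing tri

  edge-kept : ∀ {e} → e ≢ (A , C) → IsEdge n D e → IsEdge n D₂ e
  edge-kept _   (inj₁ e-bd) = inj₁ e-bd
  edge-kept e≢AC (inj₂ e∈D) = inj₂ (∈-flipTo⁺ e≢AC e∈D)

  edge-restored : ∀ {e} → e ≢ (B , D′) → IsEdge n D₂ e → IsEdge n D e
  edge-restored _ (inj₁ e-bd) = inj₁ e-bd
  edge-restored e≢BD (inj₂ e∈D₂) with ∈-flipTo⁻ {ds = D} e∈D₂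
  ... | inj₁ e≡BD = ⊥-elim (e≢BD e≡BD)
  ... | inj₂ (e∈D , _) = inj₂ e∈D

  BD-edge₂ : IsEdge n D₂ (B , D′)
  BD-edge₂ = inj₂ (here refl)

  AC-not-edge₂ : ¬ IsEdge n D₂ (A , C)
  AC-not-edge₂ (inj₁ AC-bd) = diagonal-not-boundary (IsTriangulation.diagonals tri AC∈D) AC-bd
  AC-not-edge₂ (inj₂ AC∈D₂) with ∈-flipTo⁻ {ds = D} AC∈D₂
  ... | inj₁ AC≡BD = ℕ.<⇒≢ A<B (cong proj₁ AC≡BD)
  ... | inj₂ (_ , AC≢AC) = AC≢AC refl

  BD-not-edge : ¬ IsEdge n D (B , D′)
  BD-not-edge BD = crossing D′<n C<n BD (inj₂ AC∈D) (inj₂ (A<B , B<C , C<D′))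

  triangle-on-AC : ∀ {x y z} → x < y → y < z → z < n → IsTriangle n D (x , y , z) →
    Side (A , C) (x , y , z) → (x , y , z) ≡ (A , B , C) ⊎ (x , y , z) ≡ (A , C , D′)
  triangle-on-AC {z = z} _ C<z z<n (_ , Cz , Az) (inj₁ refl) with ℕ.<-cmp z D′
  ... | tri< z<D′ _ _ = ⊥-elim (crossing z<n D′<n Az CD′ (inj₁ (A<C , C<z , z<D′)))
  ... | tri≈ _ refl _ = inj₂ refl
  ... | tri> _ _ D′<z = ⊥-elim (crossing z<n D′<n Cz AD′ (inj₂ (A<C , C<D′ , D′<z)))
  triangle-on-AC x<A _ _ (_ , _ , xC) (inj₂ (inj₁ refl)) =
    ⊥-elim (crossing C<n D′<n xC AD′ (inj₁ (x<A , A<C , C<D′)))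
  triangle-on-AC {y = y} A<y y<C _ (Ay , yC , _) (inj₂ (inj₂ refl)) with ℕ.<-cmp y B
  ... | tri< y<B _ _ = ⊥-elim (crossing C<n B<n yC AB (inj₂ (A<y , y<B , B<C)))
  ... | tri≈ _ refl _ = inj₁ refl
  ... | tri> _ _ B<y = ⊥-elim (crossing (ℕ.<-trans y<C C<n) C<n Ay BC (inj₁ (A<B , B<y , y<C)))

  private
    crossing₂ : ∀ {e f} → proj₂ e < n → proj₂ f < n → e ≢ (B , D′) →
      IsEdge n D₂ e → IsEdge n D f → ¬ Cross e f
    crossing₂ e<n f<n e≢BD e f = crossing e<n f<n (edge-restored e≢BD e) f

  triangle-on-BD : ∀ {x y z} → x < y → y < z → z < n → IsTriangle n D₂ (x , y , z) →
    Side (B , D′) (x , y , z) → (x , y , z) ≡ (A , B , D′) ⊎ (x , y , z) ≡ (B , C , D′)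
  triangle-on-BD _ D′<z z<n (_ , _ , Bz) (inj₁ refl) =
    ⊥-elim (crossing₂ z<n D′<n (ℕ.>⇒≢ D′<z ∘′ cong proj₂) Bz AD′ (inj₂ (A<B , B<D′ , D′<z)))
  triangle-on-BD {x} x<B _ _ (xB , _ , xD′) (inj₂ (inj₁ refl)) with ℕ.<-cmp x A
  ... | tri< x<A _ _ =
    ⊥-elim (crossing₂ B<n C<n (ℕ.<⇒≢ B<D′ ∘′ cong proj₂) xB (inj₂ AC∈D) (inj₁ (x<A , A<B , B<C)))
  ... | tri≈ _ refl _ = inj₁ refl
  ... | tri> _ _ A<x =
    ⊥-elim (crossing₂ D′<n B<n (ℕ.<⇒≢ x<B ∘′ cong proj₁) xD′ AB (inj₂ (A<x , x<B , B<D′)))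
  triangle-on-BD {y = y} B<y y<D′ _ (By , yD′ , _) (inj₂ (inj₂ refl)) with ℕ.<-cmp y C
  ... | tri< y<C _ _ =
    ⊥-elim (crossing₂ D′<n C<n (ℕ.>⇒≢ B<y ∘′ cong proj₁) yD′ BC (inj₂ (B<y , y<C , C<D′)))
  ... | tri≈ _ refl _ = inj₂ refl
  ... | tri> _ _ C<y =
    ⊥-elim (crossing₂ (ℕ.<-trans y<D′ D′<n) D′<n (ℕ.<⇒≢ y<D′ ∘′ cong proj₂) By CD′ (inj₁ (B<C , C<y , y<D′)))

  triangle-kept : ∀ {t@(x , y , z) : Triple} → x < y → y < z → z < n →
    t ≢ (A , B , C) → t ≢ (A , C , D′) → IsTriangle n D t → IsTriangle n D₂ t
  triangle-kept {t} x<y y<z z<n t≢ABC t≢ACD t-tri@(xy , yz , xz) =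
    keep (inj₁ refl) xy , keep (inj₂ (inj₁ refl)) yz , keep (inj₂ (inj₂ refl)) xz
    where
    keep : ∀ {e} → Side e t → IsEdge n D e → IsEdge n D₂ e
    keep side = edge-kept λ { refl → [ t≢ABC , t≢ACD ] (triangle-on-AC x<y y<z z<n t-tri side) }

  triangle-restored : ∀ {t@(x , y , z) : Triple} → x < y → y < z → z < n →
    t ≢ (A , B , D′) → t ≢ (B , C , D′) → IsTriangle n D₂ t → IsTriangle n D t
  triangle-restored {t} x<y y<z z<n t≢ABD t≢BCD t-tri@(xy , yz , xz) =
    restore (inj₁ refl) xy , restore (inj₂ (inj₁ refl)) yz , restore (inj₂ (inj₂ refl)) xz
    where
    restore : ∀ {e} → Side e t → IsEdge n D₂ e → IsEdge n D e
    restore side = edge-restored λ { refl → [ t≢ABD , t≢BCD ] (triangle-on-BD x<y y<z z<n t-tri side) }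

  ABC-triangle : IsTriangle n D (A , B , C)
  ABC-triangle = AB , BC , inj₂ AC∈D

  ACD-triangle : IsTriangle n D (A , C , D′)
  ACD-triangle = inj₂ AC∈D , CD′ , AD′

  ABD-triangle₂ : IsTriangle n D₂ (A , B , D′)
  ABD-triangle₂ =
    edge-kept (ℕ.<⇒≢ B<C ∘′ cong proj₂) AB , BD-edge₂ , edge-kept (ℕ.>⇒≢ C<D′ ∘′ cong proj₂) AD′

  BCD-triangle₂ : IsTriangle n D₂ (B , C , D′)
  BCD-triangle₂ =
    edge-kept (ℕ.>⇒≢ A<B ∘′ cong proj₁) BC , edge-kept (ℕ.>⇒≢ A<C ∘′ cong proj₁) CD′ , BD-edge₂

  triangle-unchanged : ∀ {t@(x , y , z) : Triple} → x < y → y < z → z < n →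
    t ≢ (A , B , C) → t ≢ (A , C , D′) → t ≢ (A , B , D′) → t ≢ (B , C , D′) →
    does (triangle? n D₂ t) ≡ does (triangle? n D t)
  triangle-unchanged {t} x<y y<z z<n t≢ABC t≢ACD t≢ABD t≢BCD = does-⇔
    (mk⇔ (triangle-restored x<y y<z z<n t≢ABD t≢BCD) (triangle-kept x<y y<z z<n t≢ABC t≢ACD))
    (triangle? n D₂ t) (triangle? n D t)

  module _ (f : Triple → Bool) where

    [_∧f] : Triple → Triple → ℕ
    [ u ∧f] t = ⟦ does (t ≟ₜ u) ∧ f t ⟧

    flip-pointwise : ∀ {t@(x , y , z) : Triple} → x < y → y < z → z < n →
      ⟦ does (triangle? n D₂ t) ∧ f t ⟧ + ([ A , B , C ∧f] t + [ A , C , D′ ∧f] t) ≡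
      ⟦ does (triangle? n D t) ∧ f t ⟧ + ([ A , B , D′ ∧f] t + [ B , C , D′ ∧f] t)
    flip-pointwise {t} x<y y<z z<n with t ≟ₜ (A , B , C)
    ... | yes refl
      rewrite dec-false (triangle? n D₂ (A , B , C)) (AC-not-edge₂ ∘′ proj₂ ∘′ proj₂)
            | dec-true (triangle? n D (A , B , C)) ABC-triangle
            | dec-false ((A , B , C) ≟ₜ (A , C , D′)) (ℕ.<⇒≢ B<C ∘′ cong (proj₁ ∘′ proj₂))
            | dec-false ((A , B , C) ≟ₜ (A , B , D′)) (ℕ.<⇒≢ C<D′ ∘′ cong (proj₂ ∘′ proj₂))
            | dec-false ((A , B , C) ≟ₜ (B , C , D′)) (ℕ.<⇒≢ A<B ∘′ cong proj₁) = refl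
    ... | no t≢ABC with t ≟ₜ (A , C , D′)
    ...   | yes refl
      rewrite dec-false (triangle? n D₂ (A , C , D′)) (AC-not-edge₂ ∘′ proj₁)
            | dec-true (triangle? n D (A , C , D′)) ACD-triangle
            | dec-false ((A , C , D′) ≟ₜ (A , B , D′)) (ℕ.>⇒≢ B<C ∘′ cong (proj₁ ∘′ proj₂))
            | dec-false ((A , C , D′) ≟ₜ (B , C , D′)) (ℕ.<⇒≢ A<B ∘′ cong proj₁) = sym (ℕ.+-identityʳ _)
    ...   | no t≢ACD with t ≟ₜ (A , B , D′)
    ...     | yes refl
      rewrite dec-true (triangle? n D₂ (A , B , D′)) ABD-triangle₂
            | dec-false (triangle? n D (A , B , D′)) (BD-not-edge ∘′ proj₁ ∘′ proj₂)
            | dec-false ((A , B , D′) ≟ₜ (B , C , D′)) (ℕ.<⇒≢ A<B ∘′ cong proj₁) = refl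
    ...     | no t≢ABD with t ≟ₜ (B , C , D′)
    ...       | yes refl
      rewrite dec-true (triangle? n D₂ (B , C , D′)) BCD-triangle₂
            | dec-false (triangle? n D (B , C , D′)) (BD-not-edge ∘′ proj₂ ∘′ proj₂) = ℕ.+-identityʳ _
    ...       | no t≢BCD rewrite triangle-unchanged x<y y<z z<n t≢ABC t≢ACD t≢ABD t≢BCD = refl

    flip-count :
      length (filterᵇ f (triangles n D₂)) + (⟦ f (A , B , C) ⟧ + ⟦ f (A , C , D′) ⟧) ≡
      length (filterᵇ f (triangles n D)) + (⟦ f (A , B , D′) ⟧ + ⟦ f (B , C , D′) ⟧)
    flip-count = begin
      length (filterᵇ f (triangles n D₂)) + (⟦ f (A , B , C) ⟧ + ⟦ f (A , C , D′) ⟧)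
        ≡⟨ cong₂ _+_ (length-filterᵇ-filterᵇ f _ (allTriples n))
                     (sym (cong₂ _+_ (∑-point f A<B B<C C<n) (∑-point f A<C C<D′ D′<n))) ⟩
      ∑ Δ (λ t → ⟦ does (triangle? n D₂ t) ∧ f t ⟧) + (∑ Δ [ A , B , C ∧f] + ∑ Δ [ A , C , D′ ∧f])
        ≡⟨ sym (∑-+₃ _ _ _ Δ) ⟩
      ∑ Δ (λ t → ⟦ does (triangle? n D₂ t) ∧ f t ⟧ + ([ A , B , C ∧f] t + [ A , C , D′ ∧f] t))
        ≡⟨ ∑-allTriples-cong flip-pointwise ⟩
      ∑ Δ (λ t → ⟦ does (triangle? n D t) ∧ f t ⟧ + ([ A , B , D′ ∧f] t + [ B , C , D′ ∧f] t))
        ≡⟨ ∑-+₃ _ _ _ Δ ⟩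
      ∑ Δ (λ t → ⟦ does (triangle? n D t) ∧ f t ⟧) + (∑ Δ [ A , B , D′ ∧f] + ∑ Δ [ B , C , D′ ∧f])
        ≡⟨ cong₂ _+_ (sym (length-filterᵇ-filterᵇ f _ (allTriples n)))
                     (cong₂ _+_ (∑-point f A<B B<D′ D′<n) (∑-point f B<C C<D′ D′<n)) ⟩
      length (filterᵇ f (triangles n D)) + (⟦ f (A , B , D′) ⟧ + ⟦ f (B , C , D′) ⟧) ∎
      where
      open ≡-Reasoning
      Δ = allTriples n

    flip-count-preserved : length (filterᵇ f (triangles n D₂)) ≡ length (filterᵇ f (triangles n D)) →
      ⟦ f (A , B , C) ⟧ + ⟦ f (A , C , D′) ⟧ ≡ ⟦ f (A , B , D′) ⟧ + ⟦ f (B , C , D′) ⟧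
    flip-count-preserved count≡ =
      ℕ.+-cancelˡ-≡ (length (filterᵇ f (triangles n D₂))) _ _ (trans flip-count (cong (_+ _) (sym count≡)))

  flip-type-multiplicities : ∀ σ {t₁ t₂ t₃ t₄} → typeCounts σ n D₂ ≡ typeCounts σ n D →
    TriangleHasType σ (A , B , C) t₁ → TriangleHasType σ (A , C , D′) t₂ →
    TriangleHasType σ (A , B , D′) t₃ → TriangleHasType σ (B , C , D′) t₄ →
    ∀ {X} → X ∈ properTypes → δᵀ X t₁ + δᵀ X t₂ ≡ δᵀ X t₃ + δᵀ X t₄
  flip-type-multiplicities σ {t₁} {t₂} {t₃} {t₄} counts≡ h₁ h₂ h₃ h₄ = λ
    { (here refl)                         → via first (cong first counts≡)
    ; (there (here refl))                 → via second (cong second counts≡)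
    ; (there (there (here refl)))         → via third (cong third counts≡)
    ; (there (there (there (here refl)))) → via fourth (cong fourth counts≡)
    }
    where
    first second third fourth : ∀ {V : Set} → V × V × V × V → V
    first  = proj₁
    second = proj₁ ∘′ proj₂
    third  = proj₁ ∘′ proj₂ ∘′ proj₂
    fourth = proj₂ ∘′ proj₂ ∘′ proj₂
    via : (π : Bool × Bool × Bool × Bool → Bool) →
      length (filterᵇ (π ∘′ scaleFlags σ) (triangles n D₂)) ≡
      length (filterᵇ (π ∘′ scaleFlags σ) (triangles n D)) →
      ⟦ π (flags t₁) ⟧ + ⟦ π (flags t₂) ⟧ ≡ ⟦ π (flags t₃) ⟧ + ⟦ π (flags t₄) ⟧
    via π count≡ = trans (sym (flags-pair π h₁ h₂))
      (trans (flip-count-preserved (π ∘′ scaleFlags σ) count≡) (flags-pair π h₃ h₄))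

proposition2 : (n : ℕ) → 4 ≤ n → (r : ℝ) → AtLeast3 r →
    (σ : ℕ → ℕ) → (∀ d → 1 ≤ d → IsCeilLog r d (σ d)) →
    (D : List Edge) → IsTriangulation n D →
    (A B C D′ : ℕ) → A < B → B < C → C < D′ → D′ < n →
    (A , C) ∈ D →
    isEdgeᵇ n D (A , B) ≡ true → isEdgeᵇ n D (B , C) ≡ true →
    isEdgeᵇ n D (C , D′) ≡ true → isEdgeᵇ n D (A , D′) ≡ true →
    σ (C ∸ A) ≢ σ (D′ ∸ B) → σ (D′ ∸ B) ≢ σ (C ∸ B) → σ (C ∸ A) ≢ σ (C ∸ B) →
    typeCounts σ n (flipTo (A , C) (B , D′) D) ≢ typeCounts σ n D
-- 4 ≤ n is implied by A < B < C < D′ < n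
proposition2 n _ x x≥3 σ σ-ceilLog D tri A B C D′ A<B B<C C<D′ D′<n AC∈D AB BC CD′ AD′
             p≢q q≢b p≢b counts≡ =
  flip-changes-types (quad-scales x x≥3 σ-ceilLog A<B B<C C<D′ p≢q q≢b p≢b) h₁ h₂ h₃ h₄
    (pair-≡-upTo-swap _≟ᵀ_ (δᵀ-pairs-from-proper (flip-type-multiplicities σ counts≡ h₁ h₂ h₃ h₄)))
  where
  edge : ∀ {e} → isEdgeᵇ n D e ≡ true → IsEdge n D e
  edge = does-true⇒ (edge? n D _)
  open Flip tri A<B B<C C<D′ D′<n AC∈D (edge AB) (edge BC) (edge CD′) (edge AD′)
  h₁ = proj₂ (triangleType σ (A , B , C))
  h₂ = proj₂ (triangleType σ (A , C , D′))
  h₃ = proj₂ (triangleType σ (A , B , D′))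
  h₄ = proj₂ (triangleType σ (B , C , D′))
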